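{- Let $\ell_1,\ell_2,\ell_3$ be positive integers and let $g_2$ be an integer. There exists an integer $g_3$ such that $(0,g_2,g_3)$ is a generalized spline on the edge-labeled triangle $(C_3,L)$ if and only if $g_2$ is a multiple of $\operatorname{lcm}(\ell_1,\gcd(\ell_2,\ell_3))$.
   Context: The edge-labeled triangle $(C_3,L)$ has vertices $v_1,v_2,v_3$, edge $e_1=v_1v_2$ labeled $\ell_1$, edge $e_2=v_2v_3$ labeled $\ell_2$, edge $e_3=v_3v_1$ labeled $\ell_3$. A generalized spline on $(C_3,L)$ is a triple $(g_1,g_2,g_3)\in\mathbb{Z}^3$ with $g_1\equiv g_2\pmod{\ell_1}$, $g_2\equiv g_3\pmod{\ell_2}$, $g_3\equiv g_1\pmod{\ell_3}$. -}

module Defs where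

open import Data.Nat using (ℕ)
open import Data.Integer using (ℤ; +_; _-_)
open import Data.Integer.Divisibility using (_∣_)
open import Data.Product using (_×_)

_≡_[mod_] : ℤ → ℤ → ℕ → Set
a ≡ b [mod ℓ ] = (+ ℓ) ∣ (a - b)

-- generalized spline on the edge-labeled triangle (C₃, L):
-- e₁ = v₁v₂ labeled ℓ₁, e₂ = v₂v₃ labeled ℓ₂, e₃ = v₃v₁ labeled ℓ₃
IsSplineC3 : (ℓ₁ ℓ₂ ℓ₃ : ℕ) → (g₁ g₂ g₃ : ℤ) → Set
IsSplineC3 ℓ₁ ℓ₂ ℓ₃ g₁ g₂ g₃ =
  (g₁ ≡ g₂ [mod ℓ₁ ]) × (g₂ ≡ g₃ [mod ℓ₂ ]) × (g₃ ≡ g₁ [mod ℓ₃ ])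

-- With g₁ = 0 the edge v₁v₂ says exactly that ℓ₁ divides g₂, while the other two
-- edges say that g₂ = (g₂ - g₃) + g₃ lies in ℓ₂ℤ + ℓ₃ℤ, which by Bézout is
-- gcd(ℓ₂, ℓ₃)ℤ. Being divisible by both ℓ₁ and gcd(ℓ₂, ℓ₃) means being divisible
-- by their lcm.
module Submission where

open import Defs
open import Data.Nat using (ℕ; NonZero)
open import Data.Nat.GCD using (gcd)
open import Data.Nat.LCM using (lcm)
open import Data.Integer using (ℤ; +_; 0ℤ)
open import Data.Integer.Divisibility using (_∣_)
open import Data.Product using (∃)
open import Function.Bundles using (_⇔_)

import Data.Nat as ℕ
import Data.Nat.Divisibility as ℕ
open import Data.Nat.GCD using (gcd-GCD; gcd[m,n]∣m; gcd[m,n]∣n; module Bézout)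
open import Data.Nat.LCM using (m∣lcm[m,n]; n∣lcm[m,n]; lcm-least)
import Data.Integer as ℤ
open import Data.Integer using (_+_; _-_; _*_; -_)
open import Data.Integer.Properties
  using (pos-+; pos-*; +-comm; +-identityˡ; +-identityʳ; ∣-i∣≡∣i∣; neg-distribˡ-*)
import Data.Integer.Divisibility.Signed as Signed
open import Data.Integer.Tactic.RingSolver using (solve-∀)
open import Data.Product using (∃₂; _×_; _,_; uncurry)
open import Function.Bundles using (mk⇔; Equivalence)
open import Relation.Binary.PropositionalEquality
  using (_≡_; refl; sym; trans; cong; subst; module ≡-Reasoning)

open Equivalence using (to; from)

∣i∣≡∣j∣⇒k∣i⇔k∣j : ∀ k i j → ℤ.∣ i ∣ ≡ ℤ.∣ j ∣ → k ∣ i ⇔ k ∣ j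
∣i∣≡∣j∣⇒k∣i⇔k∣j k i j ∣i∣≡∣j∣ = mk⇔ (subst (ℤ.∣ k ∣ ℕ.∣_) ∣i∣≡∣j∣) (subst (ℤ.∣ k ∣ ℕ.∣_) (sym ∣i∣≡∣j∣))

≡0[mod]⇔∣ : ∀ g ℓ → g ≡ 0ℤ [mod ℓ ] ⇔ + ℓ ∣ g
≡0[mod]⇔∣ g ℓ = ∣i∣≡∣j∣⇒k∣i⇔k∣j (+ ℓ) (g - 0ℤ) g (cong ℤ.∣_∣ (+-identityʳ g))

0≡[mod]⇔∣ : ∀ g ℓ → 0ℤ ≡ g [mod ℓ ] ⇔ + ℓ ∣ g
0≡[mod]⇔∣ g ℓ = ∣i∣≡∣j∣⇒k∣i⇔k∣j (+ ℓ) (0ℤ - g) g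
  (trans (cong ℤ.∣_∣ (+-identityˡ (- g))) (∣-i∣≡∣i∣ g))

lcm∣⇔∣×∣ : ∀ m n g → + lcm m n ∣ g ⇔ (+ m ∣ g × + n ∣ g)
lcm∣⇔∣×∣ m n g = mk⇔
  (λ lcm∣g → ℕ.∣-trans (m∣lcm[m,n] m n) lcm∣g , ℕ.∣-trans (n∣lcm[m,n] m n) lcm∣g)
  (uncurry lcm-least)

a+b≡c⇒a≡c-b : ∀ {a b c} → a + b ≡ c → a ≡ c - b
a+b≡c⇒a≡c-b {a} {b} refl = a≡a+b-b a b
  where
  a≡a+b-b : ∀ a b → a ≡ (a + b) - b
  a≡a+b-b = solve-∀

bézout-identity-over-ℤ : ∀ {d} x m y n → d ℕ.+ y ℕ.* n ≡ x ℕ.* m → + d ≡ + x * + m + - + y * + n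
bézout-identity-over-ℤ {d} x m y n eq = begin
  + d                         ≡⟨ a+b≡c⇒a≡c-b d+yn≡xm ⟩
  + x * + m - + y * + n       ≡⟨ cong (_+_ (+ x * + m)) (neg-distribˡ-* (+ y) (+ n)) ⟩
  + x * + m + - + y * + n     ∎
  where
  open ≡-Reasoning
  d+yn≡xm : + d + + y * + n ≡ + x * + m
  d+yn≡xm = begin
    + d + + y * + n           ≡⟨ cong (_+_ (+ d)) (pos-* y n) ⟨
    + d + + (y ℕ.* n)         ≡⟨ pos-+ d (y ℕ.* n) ⟨
    + (d ℕ.+ y ℕ.* n)         ≡⟨ cong +_ eq ⟩
    + (x ℕ.* m)               ≡⟨ pos-* x m ⟩
    + x * + m                 ∎

gcd-bézout : ∀ m n → ∃₂ λ x y → + gcd m n ≡ x * + m + y * + n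
gcd-bézout m n with Bézout.identity (gcd-GCD m n)
... | Bézout.+- x y eq = + x , - + y , bézout-identity-over-ℤ x m y n eq
... | Bézout.-+ x y eq = - + x , + y ,
  trans (bézout-identity-over-ℤ y n x m eq) (+-comm (+ y * + n) (- + x * + m))

IsSumOfMultiples : ℕ → ℕ → ℤ → Set
IsSumOfMultiples m n g = ∃ λ h → + m ∣ g - h × + n ∣ h

sumOfMultiples⇔gcd∣ : ∀ m n g → IsSumOfMultiples m n g ⇔ + gcd m n ∣ g
sumOfMultiples⇔gcd∣ m n g = mk⇔ sum⇒gcd∣ gcd∣⇒sum
  where
  open ≡-Reasoning
  d = gcd m n

  sum⇒gcd∣ : IsSumOfMultiples m n g → + d ∣ g
  sum⇒gcd∣ (h , m∣g-h , n∣h) = Signed.∣⇒∣ᵤ (subst (Signed._∣_ (+ d)) (g-h+h≡g g h)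
    (Signed.∣m∣n⇒∣m+n (Signed.∣-trans d∣m (Signed.∣ᵤ⇒∣ {i = g - h} m∣g-h))
                      (Signed.∣-trans d∣n (Signed.∣ᵤ⇒∣ {i = h} n∣h))))
    where
    g-h+h≡g : ∀ g h → g - h + h ≡ g
    g-h+h≡g = solve-∀
    d∣m : + d Signed.∣ + m
    d∣m = Signed.∣ᵤ⇒∣ (gcd[m,n]∣m m n)
    d∣n : + d Signed.∣ + n
    d∣n = Signed.∣ᵤ⇒∣ (gcd[m,n]∣n m n)

  gcd∣⇒sum : + d ∣ g → IsSumOfMultiples m n g
  gcd∣⇒sum d∣g with Signed.∣ᵤ⇒∣ {+ d} {g} d∣g | gcd-bézout m n
  ... | Signed.divides c refl | x , y , d≡xm+yn =
    c * y * + n , Signed.∣⇒∣ᵤ (Signed.divides (c * x) g-h≡cx*m)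
                , Signed.∣⇒∣ᵤ (Signed.∣n⇒∣m*n (c * y) Signed.∣-refl)
    where
    distribute : ∀ c x m y n → c * (x * m + y * n) - c * y * n ≡ c * x * m
    distribute = solve-∀
    g-h≡cx*m : c * + d - c * y * + n ≡ c * x * + m
    g-h≡cx*m = begin
      c * + d - c * y * + n                     ≡⟨ cong (λ e → c * e - c * y * + n) d≡xm+yn ⟩
      c * (x * + m + y * + n) - c * y * + n     ≡⟨ distribute c x (+ m) y (+ n) ⟩
      c * x * + m                               ∎

theorem3p1 : (ℓ₁ ℓ₂ ℓ₃ : ℕ) → .{{_ : NonZero ℓ₁}} → .{{_ : NonZero ℓ₂}} → .{{_ : NonZero ℓ₃}} → (g₂ : ℤ)
    → (∃ λ (g₃ : ℤ) → IsSplineC3 ℓ₁ ℓ₂ ℓ₃ 0ℤ g₂ g₃) ⇔ ((+ lcm ℓ₁ (gcd ℓ₂ ℓ₃)) ∣ g₂)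
theorem3p1 ℓ₁ ℓ₂ ℓ₃ g₂ = mk⇔ spline⇒lcm∣ lcm∣⇒spline
  where
  spline⇒lcm∣ : (∃ λ g₃ → IsSplineC3 ℓ₁ ℓ₂ ℓ₃ 0ℤ g₂ g₃) → + lcm ℓ₁ (gcd ℓ₂ ℓ₃) ∣ g₂
  spline⇒lcm∣ (g₃ , 0≡g₂ , g₂≡g₃ , g₃≡0) = from (lcm∣⇔∣×∣ ℓ₁ (gcd ℓ₂ ℓ₃) g₂)
    ( to (0≡[mod]⇔∣ g₂ ℓ₁) 0≡g₂
    , to (sumOfMultiples⇔gcd∣ ℓ₂ ℓ₃ g₂) (g₃ , g₂≡g₃ , to (≡0[mod]⇔∣ g₃ ℓ₃) g₃≡0))

  lcm∣⇒spline : + lcm ℓ₁ (gcd ℓ₂ ℓ₃) ∣ g₂ → ∃ λ g₃ → IsSplineC3 ℓ₁ ℓ₂ ℓ₃ 0ℤ g₂ g₃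
  lcm∣⇒spline lcm∣g₂ with to (lcm∣⇔∣×∣ ℓ₁ (gcd ℓ₂ ℓ₃) g₂) lcm∣g₂
  ... | ℓ₁∣g₂ , gcd∣g₂ with from (sumOfMultiples⇔gcd∣ ℓ₂ ℓ₃ g₂) gcd∣g₂
  ... | g₃ , ℓ₂∣g₂-g₃ , ℓ₃∣g₃ =
    g₃ , from (0≡[mod]⇔∣ g₂ ℓ₁) ℓ₁∣g₂ , ℓ₂∣g₂-g₃ , from (≡0[mod]⇔∣ g₃ ℓ₃) ℓ₃∣g₃
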